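{- There is no uniquely $C_4^{+}$-saturated graph with exactly two triangles, and there is no uniquely $C_4^{+}$-saturated graph with exactly three triangles.
   Context: All graphs are finite, simple and undirected. $C_4^{+}$ (the diamond) is the graph obtained from a $4$-cycle by adding one chord, i.e. $K_4$ minus an edge. For a graph $H$, a graph $G$ is uniquely $H$-saturated if $G$ contains no subgraph isomorphic to $H$, but for every pair of non-adjacent vertices $u,v$ of $G$, the graph $G+uv$ contains exactly one subgraph isomorphic to $H$. A triangle is a subgraph isomorphic to $K_3$. -}

module Defs where

open import Data.Nat using (ℕ)
open import Data.Fin using (Fin; toℕ; _≟_)
open import Data.Bool using (Bool; true; false; _∧_; _∨_; not)
open import Data.List using (List; length; filterᵇ; allFin; concatMap; map; _∷_; [])
open import Data.Product using (_×_; _,_)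
open import Relation.Nullary.Decidable using (⌊_⌋)
open import Relation.Binary.PropositionalEquality using (_≡_; _≢_)
import Data.Nat as ℕ

Adj : ℕ → Set
Adj n = Fin n → Fin n → Bool

record Graph (n : ℕ) : Set where
  field
    adj    : Adj n
    sym    : ∀ i j → adj i j ≡ adj j i
    irrefl : ∀ i → adj i i ≡ false
open Graph public

-- strict order on vertices (used only to enumerate unordered sets once)
_<ᵛ_ : ∀ {n} → Fin n → Fin n → Bool
i <ᵛ j = toℕ i ℕ.<ᵇ toℕ j

_≠ᵛ_ : ∀ {n} → Fin n → Fin n → Bool
i ≠ᵛ j = not ⌊ i ≟ j ⌋

addEdge : ∀ {n} → Adj n → Fin n → Fin n → Adj n
addEdge A u v x y =
  A x y ∨ ((⌊ x ≟ u ⌋ ∧ ⌊ y ≟ v ⌋) ∨ (⌊ x ≟ v ⌋ ∧ ⌊ y ≟ u ⌋))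

triples : ∀ n → List (Fin n × Fin n × Fin n)
triples n = concatMap (λ i → concatMap (λ j → map (λ k → i , j , k) (allFin n)) (allFin n)) (allFin n)

quads : ∀ n → List (Fin n × Fin n × Fin n × Fin n)
quads n = concatMap (λ a → map (λ t → a , t) (triples n)) (allFin n)

-- A triangle (subgraph ≅ K₃) is a 3-element vertex set {i,j,k}, pairwise
-- adjacent; listed once via i < j < k.
isTriangle : ∀ {n} → Adj n → Fin n × Fin n × Fin n → Bool
isTriangle A (i , j , k) = (i <ᵛ j) ∧ (j <ᵛ k) ∧ A i j ∧ A j k ∧ A i k

triangleCount : ∀ {n} → Adj n → ℕ
triangleCount {n} A = length (filterᵇ (isTriangle A) (triples n))

-- A subgraph isomorphic to the diamond C₄⁺ (K₄ minus an edge) on distinct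
-- vertices a,b,c,d has edge set {ab, ac, bc, ad, bd}: the chord {a,b}
-- (the two degree-3 vertices) and the two tips {c,d}. Such a subgraph is
-- determined by the unordered pair {a,b} and the unordered pair {c,d},
-- listed once via a < b and c < d.
isDiamond : ∀ {n} → Adj n → Fin n × Fin n × Fin n × Fin n → Bool
isDiamond A (a , b , c , d) =
  (a <ᵛ b) ∧ (c <ᵛ d) ∧ (a ≠ᵛ c) ∧ (a ≠ᵛ d) ∧ (b ≠ᵛ c) ∧ (b ≠ᵛ d)
  ∧ A a b ∧ A a c ∧ A b c ∧ A a d ∧ A b d

diamondCount : ∀ {n} → Adj n → ℕ
diamondCount {n} A = length (filterᵇ (isDiamond A) (quads n))

UniquelyDiamondSaturated : ∀ {n} → Graph n → Set
UniquelyDiamondSaturated G =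
  diamondCount (adj G) ≡ 0 ×
  (∀ u v → u ≢ v → adj G u v ≡ false → diamondCount (addEdge (adj G) u v) ≡ 1)

{-# OPTIONS --safe #-}
module Submission where

-- Being diamond-free, G has every edge on at most one triangle.  For a non-edge uv the unique
-- diamond of G + uv must use uv, so u and v have a common neighbour w and, besides, a second one or
-- a triangle on wu or wv; and they never have three common neighbours, as G + uv would then have two
-- diamonds.  Comparing two diamonds of G + uv in the same way shows that distinct triangles are
-- vertex-disjoint and that the outer neighbours of a triangle abc (its neighbours off abc) are
-- pairwise non-adjacent, so each of them that lies on a triangle lies on a triangle of its own.
--
-- Now let abc be one of two or three triangles; the other one forces every corner to have outer
-- neighbours.  If a has an outer neighbour u on no triangle, double counting the edges between the
-- outer neighbours Nb of b, the set N(u) ∖ {a} and the outer neighbours of a other than u gives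
-- 2|Nb| + 2 ≤ 2|Na| + #(Nb on triangles).  If two corners had such neighbours, at least four of their
-- outer neighbours would lie on triangles, while three already give four triangles.  Otherwise two
-- corners a, b have all outer neighbours on triangles.  Then a has a single outer neighbour x, and x
-- is adjacent to every vertex off abc that is not adjacent to abc; the two other corners of the
-- triangle through an outer neighbour of b are such vertices, so x has two adjacent neighbours off
-- its own triangle, which is impossible.

open import Defs renaming (sym to adj-sym; irrefl to adj-irrefl)
open import Level using (Level)
open import Data.Bool using (Bool; true; false; T; if_then_else_; _∧_; _∨_; not)
open import Data.Bool.Properties using (T-∧; T-∨; ∧-comm; ∨-comm)
open import Data.Empty using (⊥; ⊥-elim)
open import Data.Fin using (Fin; zero; suc; toℕ; _<_; _≟_)
open import Data.Fin.Properties using (any?; pigeonhole; <-cmp; <⇒≢; <-trans; <-irrefl; <-asym)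
open import Data.List
  using ( List; []; _∷_; _++_; length; lookup; filterᵇ; map; concatMap; allFin
        ; cartesianProductWith; cartesianProduct)
open import Data.List.Properties using (map-∘; map-++; concatMap-cong)
open import Data.List.Membership.Propositional using (_∈_; _∉_)
import Data.List.Membership.DecPropositional as DecMembership
open import Data.List.Membership.Propositional.Properties
  using (∈-lookup; ∈-filter⁺; ∈-filter⁻; ∈-cartesianProduct⁺; ∈-allFin)
open import Data.List.Membership.Setoid.Properties using (index-injective)
open import Data.List.Relation.Unary.Any using (here; there; index)
open import Data.List.Relation.Unary.All using (All; []; _∷_)
import Data.List.Relation.Unary.All as All
open import Data.List.Relation.Unary.All.Properties using (All¬⇒¬Any)
open import Data.List.Relation.Unary.AllPairs using ([]; _∷_)
open import Data.List.Relation.Unary.Unique.Propositional using (Unique)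
open import Data.List.Relation.Unary.Unique.Propositional.Properties using (filter⁺; cartesianProduct⁺; allFin⁺)
open import Data.List.Relation.Binary.Subset.Propositional using (_⊆_)
open import Data.List.Relation.Binary.Permutation.Propositional using (_↭_; ↭-refl; ↭-sym; ↭-trans; prep; swap)
open import Data.List.Relation.Binary.Permutation.Propositional.Properties using (∈-resp-↭)
open import Data.Nat using (ℕ; zero; suc; _+_; _≤_; z≤n; s≤s)
open import Data.Nat.Properties
  using ( +-0-commutativeMonoid; n≤1+n; ≤-refl; ≤-trans; ≤-reflexive; ≮⇒≥; <⇒<ᵇ; <ᵇ⇒<
        ; +-comm; +-identityʳ; +-suc; +-mono-≤; +-monoˡ-≤; +-cancelˡ-≤; module ≤-Reasoning)
open import Data.Nat.Tactic.RingSolver using (solve-∀)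
open import Algebra.Properties.CommutativeMonoid.Sum +-0-commutativeMonoid
  using (sum; ∑-comm; ∑-distrib-+; sum-cong-≗; sum-replicate-zero)
open import Data.Product using (∃; ∃₂; ∃-syntax; _×_; _,_; proj₁; proj₂)
open import Data.Product.Properties using (≡-dec)
open import Data.Sum using (_⊎_; inj₁; inj₂; [_,_]′)
open import Function using (_∘_; Equivalence)
open import Relation.Binary using (tri<; tri≈; tri>)
open import Relation.Binary.PropositionalEquality
  using (_≡_; _≢_; refl; sym; trans; cong; cong₂; subst; setoid; module ≡-Reasoning)
open import Relation.Nullary using (¬_; ¬?; Dec; yes; no; contradiction)
open import Relation.Nullary.Decidable
  using ( ⌊_⌋; T?; map′; _×-dec_; _⊎-dec_; toWitness; fromWitness; toWitnessFalse; fromWitnessFalse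
        ; decidable-stable)

private
  variable
    a : Level
    A : Set a
    m n : ℕ

infixr 4 _∧ᵀ_
_∧ᵀ_ : ∀ {x y} → T x → T y → T (x ∧ y)
p ∧ᵀ q = Equivalence.from T-∧ (p , q)

-- Here and below the left operand is explicit: it cannot be inferred through T.
∧ᵀ-split : ∀ x {y} → T (x ∧ y) → T x × T y
∧ᵀ-split _ = Equivalence.to T-∧

∨ᵀ-inj₁ : ∀ x {y} → T x → T (x ∨ y)
∨ᵀ-inj₁ _ p = Equivalence.from T-∨ (inj₁ p)

∨ᵀ-inj₂ : ∀ x {y} → T y → T (x ∨ y)
∨ᵀ-inj₂ _ q = Equivalence.from T-∨ (inj₂ q)

∨ᵀ-cases : ∀ x {y} → T (x ∨ y) → T x ⊎ T y
∨ᵀ-cases _ = Equivalence.to T-∨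

≢⇒≠ᵛ : ∀ {x y : Fin n} → x ≢ y → T (x ≠ᵛ y)
≢⇒≠ᵛ = fromWitnessFalse

≡⇒T≟ : ∀ {x y : Fin n} → x ≡ y → T ⌊ x ≟ y ⌋
≡⇒T≟ = fromWitness

-- Counting in lists

Unique-lookup-injective : ∀ {xs : List A} → Unique xs → ∀ {i j} → lookup xs i ≡ lookup xs j → i ≡ j
Unique-lookup-injective (_ ∷ _)    {zero}  {zero}  _  = refl
Unique-lookup-injective (x≢xs ∷ _) {zero}  {suc j} eq = ⊥-elim (All.lookup x≢xs (∈-lookup j) eq)
Unique-lookup-injective (x≢xs ∷ _) {suc i} {zero}  eq = ⊥-elim (All.lookup x≢xs (∈-lookup i) (sym eq))
Unique-lookup-injective (_ ∷ u)    {suc i} {suc j} eq = cong suc (Unique-lookup-injective u eq)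

Unique-⊆⇒length≤ : ∀ {xs ys : List A} → Unique xs → xs ⊆ ys → length xs ≤ length ys
Unique-⊆⇒length≤ {A = A} {xs} u xs⊆ys = ≮⇒≥ λ ys<xs →
  let position k = xs⊆ys (∈-lookup {xs = xs} k)
      (i , j , i<j , same) = pigeonhole ys<xs (λ i → index (position i))
  in <⇒≢ i<j (Unique-lookup-injective u (index-injective (setoid A) (position i) (position j) same))

Unique⇒length≤filter : ∀ (p : A → Bool) {xs ys : List A} →
  Unique xs → All (T ∘ p) xs → xs ⊆ ys → length xs ≤ length (filterᵇ p ys)
Unique⇒length≤filter p u pxs xs⊆ys =
  Unique-⊆⇒length≤ u (λ x∈xs → ∈-filter⁺ (T? ∘ p) (xs⊆ys x∈xs) (All.lookup pxs x∈xs))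

Unique-length≥2⇒distinct : ∀ {xs : List A} → Unique xs → 2 ≤ length xs → ∃₂ λ x y → x ≢ y × x ∈ xs × y ∈ xs
Unique-length≥2⇒distinct {xs = x ∷ y ∷ _} (x≢ ∷ _) _ = x , y , All.head x≢ , here refl , there (here refl)
Unique-length≥2⇒distinct {xs = _ ∷ []}    _ (s≤s ())

length-filter≥2⇒distinct : ∀ (p : A → Bool) {ys : List A} → Unique ys → 2 ≤ length (filterᵇ p ys) →
  ∃₂ λ x y → x ≢ y × T (p x) × T (p y)
length-filter≥2⇒distinct p {ys} u two =
  let (x , y , x≢y , x∈ , y∈) = Unique-length≥2⇒distinct (filter⁺ (T? ∘ p) u) two
  in x , y , x≢y , proj₂ (∈-filter⁻ (T? ∘ p) {xs = ys} x∈) , proj₂ (∈-filter⁻ (T? ∘ p) {xs = ys} y∈)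

length-filter≥1⇒witness : ∀ (p : A → Bool) {ys : List A} → 1 ≤ length (filterᵇ p ys) → ∃ λ x → T (p x)
length-filter≥1⇒witness p {ys} _ with filterᵇ p ys | (λ {v} → ∈-filter⁻ (T? ∘ p) {v} {ys})
... | x ∷ _ | satisfies = x , proj₂ (satisfies (here refl))

concatMap-map≡cartesianProductWith : ∀ {b c} {B : Set b} {C : Set c} (f : A → B → C) xs ys →
  concatMap (λ x → map (f x) ys) xs ≡ cartesianProductWith f xs ys
concatMap-map≡cartesianProductWith f []       ys = refl
concatMap-map≡cartesianProductWith f (x ∷ xs) ys =
  cong (map (f x) ys ++_) (concatMap-map≡cartesianProductWith f xs ys)

cartesianProductWith-uncurried : ∀ {b c} {B : Set b} {C : Set c} (f : A × B → C) xs ys →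
  cartesianProductWith (λ x y → f (x , y)) xs ys ≡ map f (cartesianProduct xs ys)
cartesianProductWith-uncurried f []       ys = refl
cartesianProductWith-uncurried f (x ∷ xs) ys = begin
  map (λ y → f (x , y)) ys ++ cartesianProductWith (λ x y → f (x , y)) xs ys
    ≡⟨ cong₂ _++_ (map-∘ ys) (cartesianProductWith-uncurried f xs ys) ⟩
  map f (map (x ,_) ys) ++ map f (cartesianProduct xs ys)
    ≡⟨ map-++ f (map (x ,_) ys) _ ⟨
  map f (cartesianProduct (x ∷ xs) ys) ∎
  where open ≡-Reasoning

-- Counting over Fin n

∑⟨_⟩ : (Fin n → Bool) → (Fin n → ℕ) → ℕ
∑⟨ P ⟩ f = sum (λ x → if P x then f x else 0)

count : (Fin n → Bool) → ℕ
count P = ∑⟨ P ⟩ (λ _ → 1)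

infixl 6 _─_
_─_ : (Fin n → Bool) → Fin n → (Fin n → Bool)
(P ─ u) x = P x ∧ not ⌊ x ≟ u ⌋

sum-mono-≤ : {f g : Fin n → ℕ} → (∀ i → f i ≤ g i) → sum f ≤ sum g
sum-mono-≤ {zero}  f≤g = z≤n
sum-mono-≤ {suc n} f≤g = +-mono-≤ (f≤g zero) (sum-mono-≤ (f≤g ∘ suc))

∑⟨⟩-mono-≤ : ∀ (P : Fin n → Bool) {f g} → (∀ {x} → T (P x) → f x ≤ g x) → ∑⟨ P ⟩ f ≤ ∑⟨ P ⟩ g
∑⟨⟩-mono-≤ P f≤g = sum-mono-≤ (λ x → guarded (P x) (f≤g {x}))
  where
  guarded : ∀ b {i j} → (T b → i ≤ j) → (if b then i else 0) ≤ (if b then j else 0)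
  guarded true  i≤j = i≤j _
  guarded false _   = z≤n

∑⟨⟩-distrib-+ : ∀ (P : Fin n → Bool) f g → ∑⟨ P ⟩ (λ x → f x + g x) ≡ ∑⟨ P ⟩ f + ∑⟨ P ⟩ g
∑⟨⟩-distrib-+ P f g =
  trans (sum-cong-≗ (λ x → guarded (P x) (f x) (g x)))
        (∑-distrib-+ (λ x → if P x then f x else 0) (λ x → if P x then g x else 0))
  where
  guarded : ∀ b i j → (if b then i + j else 0) ≡ (if b then i else 0) + (if b then j else 0)
  guarded true  _ _ = refl
  guarded false _ _ = refl

∑⟨⟩-indicator : ∀ (P Q : Fin n → Bool) → ∑⟨ P ⟩ (λ x → if Q x then 1 else 0) ≡ count (λ x → P x ∧ Q x)
∑⟨⟩-indicator P Q = sum-cong-≗ (λ x → guarded (P x))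
  where
  guarded : ∀ b {c} → (if b then (if c then 1 else 0) else 0) ≡ (if b ∧ c then 1 else 0)
  guarded true  = refl
  guarded false = refl

count-∑-comm : ∀ (P : Fin m → Bool) (Q : Fin n → Bool) (R : Fin m → Fin n → Bool) →
  ∑⟨ P ⟩ (λ x → count (λ y → Q y ∧ R x y)) ≡ ∑⟨ Q ⟩ (λ y → count (λ x → P x ∧ R x y))
count-∑-comm {m} {n} P Q R = begin
  ∑⟨ P ⟩ (λ x → count (λ y → Q y ∧ R x y))
    ≡⟨ sum-cong-≗ (λ x → guard-inside (P x) (λ y → if Q y ∧ R x y then 1 else 0)) ⟩
  sum (λ x → sum (λ y → if P x then (if Q y ∧ R x y then 1 else 0) else 0))
    ≡⟨ ∑-comm (λ x y → if P x then (if Q y ∧ R x y then 1 else 0) else 0) ⟩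
  sum (λ y → sum (λ x → if P x then (if Q y ∧ R x y then 1 else 0) else 0))
    ≡⟨ sum-cong-≗ (λ y → sum-cong-≗ (λ x → swap-guards (P x) (Q y) (R x y))) ⟩
  sum (λ y → sum (λ x → if Q y then (if P x ∧ R x y then 1 else 0) else 0))
    ≡⟨ sum-cong-≗ (λ y → sym (guard-inside (Q y) (λ x → if P x ∧ R x y then 1 else 0))) ⟩
  ∑⟨ Q ⟩ (λ y → count (λ x → P x ∧ R x y)) ∎
  where
  open ≡-Reasoning
  guard-inside : ∀ {k} b (f : Fin k → ℕ) → (if b then sum f else 0) ≡ sum (λ i → if b then f i else 0)
  guard-inside     true  _ = refl
  guard-inside {k} false _ = sym (sum-replicate-zero k)
  swap-guards : ∀ p q r →
    (if p then (if q ∧ r then 1 else 0) else 0) ≡ (if q then (if p ∧ r then 1 else 0) else 0)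
  swap-guards true  true  _ = refl
  swap-guards true  false _ = refl
  swap-guards false true  _ = refl
  swap-guards false false _ = refl

double-counting : ∀ (P : Fin m → Bool) (Q : Fin n → Bool) (R : Fin m → Fin n → Bool) {f g} →
  (∀ {x} → T (P x) → f x ≤ count (λ y → Q y ∧ R x y)) →
  (∀ {y} → T (Q y) → count (λ x → P x ∧ R x y) ≤ g y) →
  ∑⟨ P ⟩ f ≤ ∑⟨ Q ⟩ g
double-counting P Q R lower upper =
  ≤-trans (∑⟨⟩-mono-≤ P lower) (≤-trans (≤-reflexive (count-∑-comm P Q R)) (∑⟨⟩-mono-≤ Q upper))

count≡0 : ∀ (P : Fin n → Bool) → (∀ x → ¬ T (P x)) → count P ≡ 0
count≡0 {n} P none = trans (sum-cong-≗ (λ x → guarded (P x) (none x))) (sum-replicate-zero n)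
  where
  guarded : ∀ b → ¬ T b → (if b then 1 else 0) ≡ 0
  guarded true  ¬b = ⊥-elim (¬b _)
  guarded false _  = refl

count-singleton : ∀ (u : Fin n) → count (λ x → ⌊ x ≟ u ⌋) ≡ 1
count-singleton {suc n} zero    = cong suc (sum-replicate-zero n)
count-singleton {suc n} (suc u) =
  trans (sum-cong-≗ (λ x → cong (λ b → if b then 1 else 0) (suc-≟-suc x))) (count-singleton u)
  where
  suc-≟-suc : ∀ x → ⌊ suc x ≟ suc u ⌋ ≡ ⌊ x ≟ u ⌋
  suc-≟-suc x with x ≟ u
  ... | yes _ = refl
  ... | no  _ = refl

count-remove : ∀ (P : Fin n → Bool) {u} → T (P u) → count P ≡ suc (count (P ─ u))
count-remove P {u} Pu = begin
  count P
    ≡⟨ sum-cong-≗ split ⟩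
  sum (λ x → (if (P ─ u) x then 1 else 0) + (if ⌊ x ≟ u ⌋ then 1 else 0))
    ≡⟨ ∑-distrib-+ (λ x → if (P ─ u) x then 1 else 0) (λ x → if ⌊ x ≟ u ⌋ then 1 else 0) ⟩
  count (P ─ u) + count (λ x → ⌊ x ≟ u ⌋)
    ≡⟨ cong (count (P ─ u) +_) (count-singleton u) ⟩
  count (P ─ u) + 1
    ≡⟨ +-comm _ 1 ⟩
  suc (count (P ─ u)) ∎
  where
  open ≡-Reasoning
  at-u : ∀ b → T b → (if b then 1 else 0) ≡ (if b ∧ false then 1 else 0) + 1
  at-u true _ = refl
  elsewhere : ∀ b → (if b then 1 else 0) ≡ (if b ∧ true then 1 else 0) + 0
  elsewhere true  = refl
  elsewhere false = refl
  split : ∀ x → (if P x then 1 else 0) ≡ (if P x ∧ not ⌊ x ≟ u ⌋ then 1 else 0) + (if ⌊ x ≟ u ⌋ then 1 else 0)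
  split x with x ≟ u
  ... | yes refl = at-u (P x) Pu
  ... | no _     = elsewhere (P x)

count≥1 : ∀ (P : Fin n → Bool) {x} → T (P x) → 1 ≤ count P
count≥1 P Px rewrite count-remove P Px = s≤s z≤n

count≥2 : ∀ (P : Fin n → Bool) {x y} → T (P x) → T (P y) → x ≢ y → 2 ≤ count P
count≥2 P {x} Px Py x≢y rewrite count-remove P Px = s≤s (count≥1 (P ─ x) (Py ∧ᵀ ≢⇒≠ᵛ (x≢y ∘ sym)))

count≤1 : ∀ (P : Fin n → Bool) → (∀ {x y} → T (P x) → T (P y) → x ≡ y) → count P ≤ 1
count≤1 P unique with any? (λ x → T? (P x))
... | no none = ≤-trans (≤-reflexive (count≡0 P (λ x Px → none (x , Px)))) z≤n
... | yes (u , Pu) rewrite count-remove P Pu = s≤s (≤-reflexive (count≡0 _ only-u))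
  where
  only-u : ∀ x → ¬ T ((P ─ u) x)
  only-u x h = let (Px , x≢u) = ∧ᵀ-split (P x) h in toWitnessFalse x≢u (unique Px Pu)

count≤2 : ∀ (P : Fin n → Bool) →
  (∀ {x y z} → T (P x) → T (P y) → T (P z) → x ≢ y → x ≢ z → y ≢ z → ⊥) → count P ≤ 2
count≤2 P no-three with any? (λ x → T? (P x))
... | no none = ≤-trans (≤-reflexive (count≡0 P (λ x Px → none (x , Px)))) z≤n
... | yes (u , Pu) rewrite count-remove P Pu = s≤s (count≤1 _ at-most-one-more)
  where
  at-most-one-more : ∀ {x y} → T ((P ─ u) x) → T ((P ─ u) y) → x ≡ y
  at-most-one-more {x} {y} hx hy with x ≟ y
  ... | yes x≡y = x≡y
  ... | no  x≢y =
    let (Px , x≢u) = ∧ᵀ-split (P x) hx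
        (Py , y≢u) = ∧ᵀ-split (P y) hy
    in ⊥-elim (no-three Pu Px Py (toWitnessFalse x≢u ∘ sym) (toWitnessFalse y≢u ∘ sym) x≢y)

count-∨ : ∀ (P Q : Fin n → Bool) → (∀ x → T (P x) → T (Q x) → ⊥) →
  count (λ x → P x ∨ Q x) ≡ count P + count Q
count-∨ P Q disjoint =
  trans (sum-cong-≗ (λ x → guarded (P x) (Q x) (disjoint x)))
        (∑-distrib-+ (λ x → if P x then 1 else 0) (λ x → if Q x then 1 else 0))
  where
  guarded : ∀ p q → (T p → T q → ⊥) → (if p ∨ q then 1 else 0) ≡ (if p then 1 else 0) + (if q then 1 else 0)
  guarded true  true  d = ⊥-elim (d _ _)
  guarded true  false _ = refl
  guarded false true  _ = refl
  guarded false false _ = refl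

-- Triangles and diamonds

Adjacent : Graph n → Fin n → Fin n → Set
Adjacent H x y = T (adj H x y)

module _ (H : Graph n) where

  adjacent-sym : ∀ {x y} → Adjacent H x y → Adjacent H y x
  adjacent-sym {x} {y} = subst T (adj-sym H x y)

  adjacent⇒≢ : ∀ {x y} → Adjacent H x y → x ≢ y
  adjacent⇒≢ {x} x~x refl = subst T (adj-irrefl H x) x~x

  record Triangle (a b c : Fin n) : Set where
    constructor triangle
    field
      a~b : Adjacent H a b
      b~c : Adjacent H b c
      a~c : Adjacent H a c

  record Diamond (s t p q : Fin n) : Set where
    constructor diamond
    field
      s~t : Adjacent H s t
      s~p : Adjacent H s p
      t~p : Adjacent H t p
      s~q : Adjacent H s q
      t~q : Adjacent H t q
      p≢q : p ≢ q

Triangle-swap₁₂ : ∀ {H : Graph n} {a b c} → Triangle H a b c → Triangle H b a c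
Triangle-swap₁₂ {H = H} (triangle ab bc ac) = triangle (adjacent-sym H ab) ac bc

Triangle-swap₂₃ : ∀ {H : Graph n} {a b c} → Triangle H a b c → Triangle H a c b
Triangle-swap₂₃ {H = H} (triangle ab bc ac) = triangle ac (adjacent-sym H bc) ab

Triangle-rotate : ∀ {H : Graph n} {a b c} → Triangle H a b c → Triangle H b c a
Triangle-rotate {H = H} (triangle ab bc ac) = triangle bc (adjacent-sym H ac) (adjacent-sym H ab)

Diamond-swap-chord : ∀ {H : Graph n} {s t p q} → Diamond H s t p q → Diamond H t s p q
Diamond-swap-chord {H = H} (diamond st sp tp sq tq p≢q) = diamond (adjacent-sym H st) tp sp tq sq p≢q

Diamond-swap-tips : ∀ {H : Graph n} {s t p q} → Diamond H s t p q → Diamond H s t q p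
Diamond-swap-tips (diamond st sp tp sq tq p≢q) = diamond st sq tq sp tp (p≢q ∘ sym)

module _ {H : Graph n} where

  Triangle-through-corner : ∀ {i j k x} → Triangle H i j k → x ∈ i ∷ j ∷ k ∷ [] → ∃₂ λ y z → Triangle H x y z
  Triangle-through-corner ijk (here refl)                 = _ , _ , ijk
  Triangle-through-corner ijk (there (here refl))         = _ , _ , Triangle-swap₁₂ ijk
  Triangle-through-corner ijk (there (there (here refl))) = _ , _ , Triangle-rotate (Triangle-rotate ijk)

  Triangle-corner-adjacent : ∀ {x y z w} → Triangle H x y z → w ∈ x ∷ y ∷ z ∷ [] → w ≡ x ⊎ Adjacent H x w
  Triangle-corner-adjacent _                 (here refl)                 = inj₁ refl
  Triangle-corner-adjacent (triangle xy _ _) (there (here refl))         = inj₂ xy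
  Triangle-corner-adjacent (triangle _ _ xz) (there (there (here refl))) = inj₂ xz

triangleCorners : Fin n × Fin n × Fin n → List (Fin n)
triangleCorners (i , j , k) = i ∷ j ∷ k ∷ []

quadCorners : Fin n × Fin n × Fin n × Fin n → List (Fin n)
quadCorners (a , b , c , d) = a ∷ b ∷ c ∷ d ∷ []

≢⇒<⊎> : ∀ {x y : Fin n} → x ≢ y → x < y ⊎ y < x
≢⇒<⊎> {x = x} {y} x≢y with <-cmp x y
... | tri< x<y _ _ = inj₁ x<y
... | tri≈ _ x≡y _ = ⊥-elim (x≢y x≡y)
... | tri> _ _ y<x = inj₂ y<x

module _ (H : Graph n) where

  sorted-isTriangle : ∀ {i j k} → Triangle H i j k → i < j → j < k → T (isTriangle (adj H) (i , j , k))
  sorted-isTriangle (triangle ij jk ik) i<j j<k = <⇒<ᵇ i<j ∧ᵀ <⇒<ᵇ j<k ∧ᵀ ij ∧ᵀ jk ∧ᵀ ik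

  isTriangle⇒Triangle : ∀ {i j k} → T (isTriangle (adj H) (i , j , k)) → Triangle H i j k
  isTriangle⇒Triangle {i} {j} {k} h =
    let (_ , h) = ∧ᵀ-split (i <ᵛ j) h
        (_ , h) = ∧ᵀ-split (j <ᵛ k) h
        (ij , h) = ∧ᵀ-split (adj H i j) h
        (jk , ik) = ∧ᵀ-split (adj H j k) h
    in triangle ij jk ik

  isTriangle⇒sorted : ∀ {i j k} → T (isTriangle (adj H) (i , j , k)) → i < j × j < k
  isTriangle⇒sorted {i} {j} {k} h =
    let (i<j , h) = ∧ᵀ-split (i <ᵛ j) h
        (j<k , _) = ∧ᵀ-split (j <ᵛ k) h
    in <ᵇ⇒< (toℕ i) (toℕ j) i<j , <ᵇ⇒< (toℕ j) (toℕ k) j<k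

  Triangle⇒isTriangle : ∀ {a b c} → Triangle H a b c →
    ∃ λ t → T (isTriangle (adj H) t) × triangleCorners t ↭ a ∷ b ∷ c ∷ []
  Triangle⇒isTriangle {a} {b} {c} abc@(triangle ab bc ac)
    with ≢⇒<⊎> (adjacent⇒≢ H ab) | ≢⇒<⊎> (adjacent⇒≢ H bc) | ≢⇒<⊎> (adjacent⇒≢ H ac)
  ... | inj₁ a<b | inj₁ b<c | _ =
    (a , b , c) , sorted-isTriangle abc a<b b<c , ↭-refl
  ... | inj₁ a<b | inj₂ c<b | inj₁ a<c =
    (a , c , b) , sorted-isTriangle (Triangle-swap₂₃ abc) a<c c<b ,
    prep a (swap c b ↭-refl)
  ... | inj₁ a<b | inj₂ c<b | inj₂ c<a =
    (c , a , b) , sorted-isTriangle (Triangle-rotate (Triangle-rotate abc)) c<a a<b ,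
    ↭-trans (swap c a ↭-refl) (prep a (swap c b ↭-refl))
  ... | inj₂ b<a | _ | inj₁ a<c =
    (b , a , c) , sorted-isTriangle (Triangle-swap₁₂ abc) b<a a<c , swap b a ↭-refl
  ... | inj₂ b<a | inj₁ b<c | inj₂ c<a =
    (b , c , a) , sorted-isTriangle (Triangle-rotate abc) b<c c<a ,
    ↭-trans (prep b (swap c a ↭-refl)) (swap b a ↭-refl)
  ... | inj₂ b<a | inj₂ c<b | inj₂ _ =
    (c , b , a) , sorted-isTriangle (Triangle-rotate (Triangle-swap₂₃ abc)) c<b b<a ,
    ↭-trans (swap c b ↭-refl) (↭-trans (prep b (swap c a ↭-refl)) (swap b a ↭-refl))

  sorted-isDiamond : ∀ {a b c d} → Diamond H a b c d → a < b → c < d → T (isDiamond (adj H) (a , b , c , d))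
  sorted-isDiamond (diamond ab ac bc ad bd c≢d) a<b c<d =
    <⇒<ᵇ a<b ∧ᵀ <⇒<ᵇ c<d ∧ᵀ
    ≢⇒≠ᵛ (adjacent⇒≢ H ac) ∧ᵀ ≢⇒≠ᵛ (adjacent⇒≢ H ad) ∧ᵀ ≢⇒≠ᵛ (adjacent⇒≢ H bc) ∧ᵀ ≢⇒≠ᵛ (adjacent⇒≢ H bd) ∧ᵀ
    ab ∧ᵀ ac ∧ᵀ bc ∧ᵀ ad ∧ᵀ bd

  isDiamond⇒Diamond : ∀ {a b c d} → T (isDiamond (adj H) (a , b , c , d)) → Diamond H a b c d
  isDiamond⇒Diamond {a} {b} {c} {d} h =
    let (_ , h) = ∧ᵀ-split (a <ᵛ b) h
        (c<d , h) = ∧ᵀ-split (c <ᵛ d) h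
        (_ , h) = ∧ᵀ-split (a ≠ᵛ c) h
        (_ , h) = ∧ᵀ-split (a ≠ᵛ d) h
        (_ , h) = ∧ᵀ-split (b ≠ᵛ c) h
        (_ , h) = ∧ᵀ-split (b ≠ᵛ d) h
        (ab , h) = ∧ᵀ-split (adj H a b) h
        (ac , h) = ∧ᵀ-split (adj H a c) h
        (bc , h) = ∧ᵀ-split (adj H b c) h
        (ad , bd) = ∧ᵀ-split (adj H a d) h
    in diamond ab ac bc ad bd (<⇒≢ (<ᵇ⇒< (toℕ c) (toℕ d) c<d))

  Diamond⇒isDiamond : ∀ {s t p q} → Diamond H s t p q →
    ∃ λ z → T (isDiamond (adj H) z) × quadCorners z ↭ s ∷ t ∷ p ∷ q ∷ []
  Diamond⇒isDiamond {s} {t} {p} {q} D with ≢⇒<⊎> (adjacent⇒≢ H (Diamond.s~t D)) | ≢⇒<⊎> (Diamond.p≢q D)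
  ... | inj₁ s<t | inj₁ p<q =
    (s , t , p , q) , sorted-isDiamond D s<t p<q , ↭-refl
  ... | inj₁ s<t | inj₂ q<p =
    (s , t , q , p) , sorted-isDiamond (Diamond-swap-tips D) s<t q<p , prep s (prep t (swap q p ↭-refl))
  ... | inj₂ t<s | inj₁ p<q =
    (t , s , p , q) , sorted-isDiamond (Diamond-swap-chord D) t<s p<q , swap t s ↭-refl
  ... | inj₂ t<s | inj₂ q<p =
    (t , s , q , p) , sorted-isDiamond (Diamond-swap-tips (Diamond-swap-chord D)) t<s q<p ,
    swap t s (swap q p ↭-refl)

corner-separates : ∀ {t t′ : Fin n × Fin n × Fin n} {v} →
  v ∈ triangleCorners t′ → v ∉ triangleCorners t → t ≢ t′
corner-separates v∈t′ v∉t refl = v∉t v∈t′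

quads≡cartesianProduct : quads n ≡ cartesianProduct (allFin n) (triples n)
quads≡cartesianProduct {n} = concatMap-map≡cartesianProductWith _,_ (allFin n) (triples n)

triples≡cartesianProduct : triples n ≡ cartesianProduct (allFin n) (cartesianProduct (allFin n) (allFin n))
triples≡cartesianProduct {n} = begin
  concatMap (λ i → concatMap (λ j → map (λ k → i , j , k) (allFin n)) (allFin n)) (allFin n)
    ≡⟨ concatMap-cong (λ i → concatMap-map≡cartesianProductWith (λ j k → i , j , k) (allFin n) (allFin n))
                     (allFin n) ⟩
  concatMap (λ i → cartesianProductWith (λ j k → i , j , k) (allFin n) (allFin n)) (allFin n)
    ≡⟨ concatMap-cong (λ i → cartesianProductWith-uncurried (i ,_) (allFin n) (allFin n)) (allFin n) ⟩
  concatMap (λ i → map (i ,_) (cartesianProduct (allFin n) (allFin n))) (allFin n)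
    ≡⟨ concatMap-map≡cartesianProductWith _,_ (allFin n) _ ⟩
  cartesianProduct (allFin n) (cartesianProduct (allFin n) (allFin n)) ∎
  where open ≡-Reasoning

∈-triples : ∀ (t : Fin n × Fin n × Fin n) → t ∈ triples n
∈-triples {n} (i , j , k) = subst ((i , j , k) ∈_) (sym triples≡cartesianProduct)
  (∈-cartesianProduct⁺ (∈-allFin i) (∈-cartesianProduct⁺ (∈-allFin j) (∈-allFin k)))

∈-quads : ∀ (z : Fin n × Fin n × Fin n × Fin n) → z ∈ quads n
∈-quads (a , t) =
  subst ((a , t) ∈_) (sym quads≡cartesianProduct) (∈-cartesianProduct⁺ (∈-allFin a) (∈-triples t))

Unique-triples : Unique (triples n)
Unique-triples {n} = subst Unique (sym triples≡cartesianProduct)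
  (cartesianProduct⁺ (allFin⁺ n) (cartesianProduct⁺ (allFin⁺ n) (allFin⁺ n)))

module _ {a b c : Fin n} (a<b : a < b) (b<c : b < c) where
  private
    above-a : ∀ {x y} → x ∈ a ∷ b ∷ c ∷ [] → x < y → a < y
    above-a (here refl)                 x<y = x<y
    above-a (there (here refl))         x<y = <-trans a<b x<y
    above-a (there (there (here refl))) x<y = <-trans (<-trans a<b b<c) x<y

    below-c : ∀ {x y} → x ∈ a ∷ b ∷ c ∷ [] → y < x → y < c
    below-c (here refl)                 y<x = <-trans y<x (<-trans a<b b<c)
    below-c (there (here refl))         y<x = <-trans y<x b<c
    below-c (there (there (here refl))) y<x = y<x

    pick-middle : ∀ {x} → x ∈ a ∷ b ∷ c ∷ [] → a < x → x < c → x ≡ b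
    pick-middle (here refl)                 a<a _   = ⊥-elim (<-irrefl refl a<a)
    pick-middle (there (here refl))         _   _   = refl
    pick-middle (there (there (here refl))) _   c<c = ⊥-elim (<-irrefl refl c<c)

    pick-first : ∀ {x} → x ∈ a ∷ b ∷ c ∷ [] → x < b → x ≡ a
    pick-first (here refl)                 _   = refl
    pick-first (there (here refl))         b<b = ⊥-elim (<-irrefl refl b<b)
    pick-first (there (there (here refl))) c<b = ⊥-elim (<-asym b<c c<b)

    pick-last : ∀ {x} → x ∈ a ∷ b ∷ c ∷ [] → b < x → x ≡ c
    pick-last (here refl)                 b<a = ⊥-elim (<-asym a<b b<a)
    pick-last (there (here refl))         b<b = ⊥-elim (<-irrefl refl b<b)
    pick-last (there (there (here refl))) _   = refl

  sorted-corners-unique : ∀ {i j k} → i < j → j < k →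
    i ∈ a ∷ b ∷ c ∷ [] → j ∈ a ∷ b ∷ c ∷ [] → k ∈ a ∷ b ∷ c ∷ [] → (i , j , k) ≡ (a , b , c)
  sorted-corners-unique i<j j<k i∈ j∈ k∈ with pick-middle j∈ (above-a i∈ i<j) (below-c k∈ j<k)
  ... | refl with pick-first i∈ i<j | pick-last k∈ j<k
  ... | refl | refl = refl

module _ (H : Graph n) where
  open DecMembership (_≟_ {n}) using (_∈?_)

  diamondCount≡0⇒¬Diamond : diamondCount (adj H) ≡ 0 → ∀ {s t p q} → ¬ Diamond H s t p q
  diamondCount≡0⇒¬Diamond none D =
    let (z , z-diamond , _) = Diamond⇒isDiamond H D
        one = Unique⇒length≤filter (isDiamond (adj H)) ([] ∷ []) (z-diamond ∷ [])
                (λ { (here refl) → ∈-quads z })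
    in contradiction (subst (1 ≤_) none one) λ ()

  diamondCount≡1⇒Diamond : diamondCount (adj H) ≡ 1 → ∃[ s ] ∃[ t ] ∃[ p ] ∃[ q ] Diamond H s t p q
  diamondCount≡1⇒Diamond one =
    let ((s , t , p , q) , isD) = length-filter≥1⇒witness (isDiamond (adj H)) {quads n} (≤-reflexive (sym one))
    in s , t , p , q , isDiamond⇒Diamond H isD

  diamondCount≤1⇒same-corners : diamondCount (adj H) ≤ 1 → ∀ {s t p q s′ t′ p′ q′} →
    Diamond H s t p q → Diamond H s′ t′ p′ q′ → s ∷ t ∷ p ∷ q ∷ [] ↭ s′ ∷ t′ ∷ p′ ∷ q′ ∷ []
  diamondCount≤1⇒same-corners at-most-one D D′
    with Diamond⇒isDiamond H D | Diamond⇒isDiamond H D′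
  ... | z , z-diamond , z↭ | z′ , z′-diamond , z′↭ with ≡-dec _≟_ (≡-dec _≟_ (≡-dec _≟_ _≟_)) z z′
  ... | yes refl = ↭-trans (↭-sym z↭) z′↭
  ... | no z≢z′  = contradiction (≤-trans two at-most-one) λ { (s≤s ()) }
    where
    two = Unique⇒length≤filter (isDiamond (adj H)) ((z≢z′ ∷ []) ∷ [] ∷ []) (z-diamond ∷ z′-diamond ∷ [])
            (λ {x} _ → ∈-quads x)

  Unique⇒length≤triangleCount : ∀ {ts} → Unique ts → All (T ∘ isTriangle (adj H)) ts →
    length ts ≤ triangleCount (adj H)
  Unique⇒length≤triangleCount u triangles = Unique⇒length≤filter _ u triangles (λ {t} _ → ∈-triples t)

  triangleCount≥2⇒distinct : 2 ≤ triangleCount (adj H) →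
    ∃₂ λ t t′ → t ≢ t′ × T (isTriangle (adj H) t) × T (isTriangle (adj H) t′)
  triangleCount≥2⇒distinct = length-filter≥2⇒distinct (isTriangle (adj H)) Unique-triples

  distinct-triangles⇒outside-corner : ∀ {t t′} → T (isTriangle (adj H) t) → T (isTriangle (adj H) t′) → t ≢ t′ →
    ∃ λ x → x ∈ triangleCorners t′ × x ∉ triangleCorners t
  distinct-triangles⇒outside-corner {a , b , c} {i , j , k} abc ijk t≢t′
    with i ∈? a ∷ b ∷ c ∷ [] | j ∈? a ∷ b ∷ c ∷ [] | k ∈? a ∷ b ∷ c ∷ []
  ... | no i∉ | _     | _     = i , here refl , i∉
  ... | yes _ | no j∉ | _     = j , there (here refl) , j∉
  ... | yes _ | yes _ | no k∉ = k , there (there (here refl)) , k∉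
  ... | yes i∈ | yes j∈ | yes k∈ =
    let (a<b , b<c) = isTriangle⇒sorted H abc
        (i<j , j<k) = isTriangle⇒sorted H ijk
    in ⊥-elim (t≢t′ (sym (sorted-corners-unique a<b b<c i<j j<k i∈ j∈ k∈)))

-- Adding an edge

SamePair : Fin n × Fin n → Fin n × Fin n → Set
SamePair (x , y) (u , v) = (x ≡ u × y ≡ v) ⊎ (x ≡ v × y ≡ u)

SamePair-swap : ∀ {x y u v : Fin n} → SamePair (x , y) (u , v) → SamePair (y , x) (u , v)
SamePair-swap (inj₁ (x≡u , y≡v)) = inj₂ (y≡v , x≡u)
SamePair-swap (inj₂ (x≡v , y≡u)) = inj₁ (y≡u , x≡v)

module _ {u v : Fin n} (u≢v : u ≢ v) where

  SamePair-functional : ∀ {x y z} → SamePair (x , y) (u , v) → SamePair (x , z) (u , v) → y ≡ z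
  SamePair-functional (inj₁ (_ , refl))   (inj₁ (_ , refl))   = refl
  SamePair-functional (inj₁ (refl , _))   (inj₂ (x≡v , _))    = ⊥-elim (u≢v x≡v)
  SamePair-functional (inj₂ (refl , _))   (inj₁ (x≡u , _))    = ⊥-elim (u≢v (sym x≡u))
  SamePair-functional (inj₂ (_ , refl))   (inj₂ (_ , refl))   = refl

  SamePair-covers : ∀ {x y z w} → SamePair (x , y) (u , v) → SamePair (z , w) (u , v) → z ≡ x ⊎ z ≡ y
  SamePair-covers (inj₁ (refl , _)) (inj₁ (refl , _)) = inj₁ refl
  SamePair-covers (inj₁ (_ , refl)) (inj₂ (refl , _)) = inj₂ refl
  SamePair-covers (inj₂ (_ , refl)) (inj₁ (refl , _)) = inj₂ refl
  SamePair-covers (inj₂ (refl , _)) (inj₂ (refl , _)) = inj₁ refl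

  insertEdge : Graph n → Graph n
  insertEdge H = record
    { adj    = addEdge (adj H) u v
    ; sym    = λ x y → cong₂ _∨_ (adj-sym H x y)
                 (trans (∨-comm (⌊ x ≟ u ⌋ ∧ ⌊ y ≟ v ⌋) (⌊ x ≟ v ⌋ ∧ ⌊ y ≟ u ⌋))
                        (cong₂ _∨_ (∧-comm ⌊ x ≟ v ⌋ ⌊ y ≟ u ⌋) (∧-comm ⌊ x ≟ u ⌋ ⌊ y ≟ v ⌋)))
    ; irrefl = irrefl
    }
    where
    irrefl : ∀ x → addEdge (adj H) u v x x ≡ false
    irrefl x rewrite adj-irrefl H x with x ≟ u | x ≟ v
    ... | yes refl | yes refl = ⊥-elim (u≢v refl)
    ... | yes _    | no _     = refl
    ... | no _     | yes _    = refl
    ... | no _     | no _     = refl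

  module _ (H : Graph n) where

    insertEdge-old : ∀ {x y} → Adjacent H x y → Adjacent (insertEdge H) x y
    insertEdge-old {x} {y} = ∨ᵀ-inj₁ (adj H x y)

    insertEdge-new : Adjacent (insertEdge H) u v
    insertEdge-new =
      ∨ᵀ-inj₂ (adj H u v) (∨ᵀ-inj₁ (⌊ u ≟ u ⌋ ∧ ⌊ v ≟ v ⌋) (≡⇒T≟ {x = u} refl ∧ᵀ ≡⇒T≟ {x = v} refl))

    insertEdge-cases : ∀ {x y} → Adjacent (insertEdge H) x y → Adjacent H x y ⊎ SamePair (x , y) (u , v)
    insertEdge-cases {x} {y} xy with ∨ᵀ-cases (adj H x y) xy
    ... | inj₁ old = inj₁ old
    ... | inj₂ new with ∨ᵀ-cases (⌊ x ≟ u ⌋ ∧ ⌊ y ≟ v ⌋) new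
    ... | inj₁ uv = let (x≡u , y≡v) = ∧ᵀ-split ⌊ x ≟ u ⌋ uv in inj₂ (inj₁ (toWitness x≡u , toWitness y≡v))
    ... | inj₂ vu = let (x≡v , y≡u) = ∧ᵀ-split ⌊ x ≟ v ⌋ vu in inj₂ (inj₂ (toWitness x≡v , toWitness y≡u))

cross-bounds : ∀ x y p q → x + 2 ≤ y + p → y + 2 ≤ x + q → 4 ≤ p + q
cross-bounds x y p q h₁ h₂ = +-cancelˡ-≤ (x + y) 4 (p + q) (begin
  x + y + 4           ≡⟨ rearrange₁ x y ⟩
  (x + 2) + (y + 2)   ≤⟨ +-mono-≤ h₁ h₂ ⟩
  (y + p) + (x + q)   ≡⟨ rearrange₂ x y p q ⟩
  x + y + (p + q)     ∎)
  where
  open ≤-Reasoning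
  rearrange₁ : ∀ x y → x + y + 4 ≡ (x + 2) + (y + 2)
  rearrange₁ = solve-∀
  rearrange₂ : ∀ x y p q → (y + p) + (x + q) ≡ x + y + (p + q)
  rearrange₂ = solve-∀

-- Uniquely diamond-saturated graphs

module UniquelySaturated {n : ℕ} (G : Graph n) (uds : UniquelyDiamondSaturated G) where

  infix 4 _~_
  _~_ : Fin n → Fin n → Set
  x ~ y = Adjacent G x y

  _~?_ : ∀ x y → Dec (x ~ y)
  x ~? y = T? (adj G x y)

  ~-sym : ∀ {x y} → x ~ y → y ~ x
  ~-sym = adjacent-sym G

  ~⇒≢ : ∀ {x y} → x ~ y → x ≢ y
  ~⇒≢ = adjacent⇒≢ G

  ≁⇒adj≡false : ∀ {x y} → ¬ x ~ y → adj G x y ≡ false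
  ≁⇒adj≡false {x} {y} x≁y with adj G x y
  ... | true  = ⊥-elim (x≁y _)
  ... | false = refl

  no-diamond : ∀ {s t p q} → ¬ Diamond G s t p q
  no-diamond = diamondCount≡0⇒¬Diamond G (proj₁ uds)

  Outside : Fin n → Fin n → Fin n → Fin n → Set
  Outside a b c x = x ≢ a × x ≢ b × x ≢ c

  Near : Fin n → Fin n → Fin n → Fin n → Set
  Near a b c x = x ~ a ⊎ x ~ b ⊎ x ~ c

  triangle-apex-unique : ∀ {a b c p} → Triangle G a b c → p ~ a → p ~ b → p ≡ c
  triangle-apex-unique {c = c} {p} (triangle ab bc ac) pa pb with p ≟ c
  ... | yes p≡c = p≡c
  ... | no  p≢c = ⊥-elim (no-diamond (diamond ab ac bc (~-sym pa) (~-sym pb) (p≢c ∘ sym)))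

  record CommonNeighbour (u v : Fin n) : Set where
    constructor common-neighbour
    field
      w     : Fin n
      w~u   : w ~ u
      w~v   : w ~ v
      extra : (∃ λ w′ → w′ ≢ w × w′ ~ u × w′ ~ v) ⊎ (∃ λ q → Triangle G w u q) ⊎ (∃ λ q → Triangle G w v q)

  module AddedEdge {u v} (u≢v : u ≢ v) (u≁v : ¬ u ~ v) where

    G⁺ : Graph n
    G⁺ = insertEdge u≢v G

    infix 4 _~⁺_
    _~⁺_ : Fin n → Fin n → Set
    x ~⁺ y = Adjacent G⁺ x y

    one-diamond : diamondCount (adj G⁺) ≡ 1
    one-diamond = proj₂ uds u v u≢v (≁⇒adj≡false u≁v)

    new-diamond-corners : ∀ {s t p q s′ t′ p′ q′ x} → Diamond G⁺ s t p q → Diamond G⁺ s′ t′ p′ q′ →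
      x ∈ s′ ∷ t′ ∷ p′ ∷ q′ ∷ [] → x ∈ s ∷ t ∷ p ∷ q ∷ []
    new-diamond-corners D D′ = ∈-resp-↭ (↭-sym (diamondCount≤1⇒same-corners G⁺ (≤-reflexive one-diamond) D D′))

    old : ∀ {x y} → x ~ y → x ~⁺ y
    old = insertEdge-old u≢v G

    new : u ~⁺ v
    new = insertEdge-new u≢v G

    new′ : v ~⁺ u
    new′ = adjacent-sym G⁺ new

    unless-new : ∀ {x y} → x ~⁺ y → ¬ SamePair (x , y) (u , v) → x ~ y
    unless-new xy not-new with insertEdge-cases u≢v G xy
    ... | inj₁ x~y  = x~y
    ... | inj₂ same = ⊥-elim (not-new same)

    private
      chord-new : ∀ {s t p q} → Diamond G⁺ s t p q → SamePair (s , t) (u , v) → CommonNeighbour u v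
      chord-new {s} {t} {p} {q} (diamond st sp tp sq tq p≢q) st-new = oriented st-new
        where
        p~s = ~-sym (unless-new sp (adjacent⇒≢ G⁺ tp ∘ SamePair-functional u≢v st-new))
        p~t = ~-sym (unless-new tp (adjacent⇒≢ G⁺ sp ∘ SamePair-functional u≢v (SamePair-swap st-new)))
        q~s = ~-sym (unless-new sq (adjacent⇒≢ G⁺ tq ∘ SamePair-functional u≢v st-new))
        q~t = ~-sym (unless-new tq (adjacent⇒≢ G⁺ sq ∘ SamePair-functional u≢v (SamePair-swap st-new)))
        oriented : SamePair (s , t) (u , v) → CommonNeighbour u v
        oriented (inj₁ (refl , refl)) = common-neighbour p p~s p~t (inj₁ (q , p≢q ∘ sym , q~s , q~t))
        oriented (inj₂ (refl , refl)) = common-neighbour p p~t p~s (inj₁ (q , p≢q ∘ sym , q~t , q~s))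

      side-new : ∀ {s t p q} → Diamond G⁺ s t p q → SamePair (s , p) (u , v) → CommonNeighbour u v
      side-new {s} {t} {p} {q} (diamond st sp tp sq tq p≢q) sp-new = oriented sp-new
        where
        t~s = ~-sym (unless-new st (adjacent⇒≢ G⁺ tp ∘ λ st-new → SamePair-functional u≢v st-new sp-new))
        t~p = unless-new tp λ tp-new →
                adjacent⇒≢ G⁺ st (sym (SamePair-functional u≢v (SamePair-swap tp-new) (SamePair-swap sp-new)))
        s~q = unless-new sq (p≢q ∘ SamePair-functional u≢v sp-new)
        t~q = unless-new tq λ tq-new →
                [ (λ t≡s → adjacent⇒≢ G⁺ st (sym t≡s)) , adjacent⇒≢ G⁺ tp ]′ (SamePair-covers u≢v sp-new tq-new)
        oriented : SamePair (s , p) (u , v) → CommonNeighbour u v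
        oriented (inj₁ (refl , refl)) = common-neighbour t t~s t~p (inj₂ (inj₁ (q , triangle t~s s~q t~q)))
        oriented (inj₂ (refl , refl)) = common-neighbour t t~p t~s (inj₂ (inj₂ (q , triangle t~s s~q t~q)))

      -- The diamond must use the new edge uv: as its chord, or (up to its symmetries) as the side sp.
      new-diamond⇒common-neighbour : ∀ {s t p q} → Diamond G⁺ s t p q → CommonNeighbour u v
      new-diamond⇒common-neighbour D@(diamond st sp tp sq tq p≢q)
        with insertEdge-cases u≢v G st | insertEdge-cases u≢v G sp | insertEdge-cases u≢v G tp
           | insertEdge-cases u≢v G sq | insertEdge-cases u≢v G tq
      ... | inj₂ st-new | _ | _ | _ | _ = chord-new D st-new
      ... | inj₁ _ | inj₂ sp-new | _ | _ | _ = side-new D sp-new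
      ... | inj₁ _ | inj₁ _ | inj₂ tp-new | _ | _ = side-new (Diamond-swap-chord D) tp-new
      ... | inj₁ _ | inj₁ _ | inj₁ _ | inj₂ sq-new | _ = side-new (Diamond-swap-tips D) sq-new
      ... | inj₁ _ | inj₁ _ | inj₁ _ | inj₁ _ | inj₂ tq-new =
        side-new (Diamond-swap-tips (Diamond-swap-chord D)) tq-new
      ... | inj₁ s~t | inj₁ s~p | inj₁ t~p | inj₁ s~q | inj₁ t~q =
        ⊥-elim (no-diamond (diamond s~t s~p t~p s~q t~q p≢q))

    -- Opaque because unfolding it would make the type checker run the search for the diamond.
    opaque
      common-neighbour-of-non-edge : CommonNeighbour u v
      common-neighbour-of-non-edge =
        let (_ , _ , _ , _ , D) = diamondCount≡1⇒Diamond G⁺ one-diamond in new-diamond⇒common-neighbour D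

  no-three-common-neighbours : ∀ {u v w₁ w₂ w₃} → u ≢ v → ¬ u ~ v →
    w₁ ~ u → w₁ ~ v → w₂ ~ u → w₂ ~ v → w₃ ~ u → w₃ ~ v → w₁ ≢ w₂ → w₁ ≢ w₃ → w₂ ≢ w₃ → ⊥
  no-three-common-neighbours u≢v u≁v w₁u w₁v w₂u w₂v w₃u w₃v w₁≢w₂ w₁≢w₃ w₂≢w₃ =
    All¬⇒¬Any (~⇒≢ w₃u ∷ ~⇒≢ w₃v ∷ (w₁≢w₃ ∘ sym) ∷ (w₂≢w₃ ∘ sym) ∷ [])
      (new-diamond-corners (chord-uv w₁u w₁v w₂u w₂v w₁≢w₂) (chord-uv w₁u w₁v w₃u w₃v w₁≢w₃)
                           (there (there (there (here refl)))))
    where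
    open AddedEdge u≢v u≁v
    chord-uv : ∀ {p q} → p ~ _ → p ~ _ → q ~ _ → q ~ _ → p ≢ q → Diamond G⁺ _ _ p q
    chord-uv pu pv qu qv = diamond new (old (~-sym pu)) (old (~-sym pv)) (old (~-sym qu)) (old (~-sym qv))

  corner-neighbours-nonadjacent : ∀ {a b c p q} → Triangle G a b c → Outside a b c p → Outside a b c q →
    a ~ p → a ~ q → ¬ p ~ q
  corner-neighbours-nonadjacent {b = b} {p = p} abc@(triangle ab bc ac)
                                (p≢a , p≢b , p≢c) (q≢a , q≢b , q≢c) ap aq pq
    with b ~? p
  ... | yes bp = p≢c (triangle-apex-unique abc (~-sym ap) (~-sym bp))
  -- Otherwise G + bp has a diamond with chord ba and one with chord pa, and only the latter contains q.
  ... | no b≁p =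
    All¬⇒¬Any (q≢b ∷ q≢a ∷ q≢c ∷ ~⇒≢ (~-sym pq) ∷ [])
      (new-diamond-corners (diamond (old (~-sym ab)) (old bc) (old ac) new (old ap) (p≢c ∘ sym))
                           (diamond (old (~-sym ap)) (old pq) (old aq) new′ (old ab) q≢b)
                           (there (there (here refl))))
    where open AddedEdge (p≢b ∘ sym) b≁p

  crossing-neighbours-nonadjacent : ∀ {a b c p q} → Triangle G a b c → Outside a b c p → Outside a b c q →
    p ~ a → q ~ b → ¬ p ~ q
  crossing-neighbours-nonadjacent {b = b} {p = p} abc@(triangle ab bc ac)
                                  (p≢a , p≢b , p≢c) (q≢a , q≢b , q≢c) pa qb pq
    with p ~? b
  ... | yes pb = p≢c (triangle-apex-unique abc pa pb)
  -- Otherwise G + pb has a diamond with chord ba and one with chord pb, and only the latter contains q.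
  ... | no p≁b =
    All¬⇒¬Any (q≢b ∷ q≢a ∷ q≢c ∷ ~⇒≢ (~-sym pq) ∷ [])
      (new-diamond-corners (diamond (old (~-sym ab)) (old bc) (old ac) new′ (old (~-sym pa)) (p≢c ∘ sym))
                           (diamond new (old pa) (old (~-sym ab)) (old pq) (old (~-sym qb)) (q≢a ∘ sym))
                           (there (there (there (here refl)))))
    where open AddedEdge p≢b p≁b

  Outside-swap₁₂ : ∀ {a b c x} → Outside a b c x → Outside b a c x
  Outside-swap₁₂ (x≢a , x≢b , x≢c) = x≢b , x≢a , x≢c

  Outside-swap₂₃ : ∀ {a b c x} → Outside a b c x → Outside a c b x
  Outside-swap₂₃ (x≢a , x≢b , x≢c) = x≢a , x≢c , x≢b

  Outside-rotate : ∀ {a b c x} → Outside a b c x → Outside b c a x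
  Outside-rotate (x≢a , x≢b , x≢c) = x≢b , x≢c , x≢a

  triangle-neighbours-nonadjacent : ∀ {a b c p q} → Triangle G a b c → Outside a b c p → Outside a b c q →
    Near a b c p → Near a b c q → ¬ p ~ q
  triangle-neighbours-nonadjacent abc op oq (inj₁ pa) (inj₁ qa) =
    corner-neighbours-nonadjacent abc op oq (~-sym pa) (~-sym qa)
  triangle-neighbours-nonadjacent abc op oq (inj₁ pa) (inj₂ (inj₁ qb)) =
    crossing-neighbours-nonadjacent abc op oq pa qb
  triangle-neighbours-nonadjacent abc op oq (inj₁ pa) (inj₂ (inj₂ qc)) =
    crossing-neighbours-nonadjacent (Triangle-swap₂₃ abc)
      (Outside-swap₂₃ op) (Outside-swap₂₃ oq) pa qc
  triangle-neighbours-nonadjacent abc op oq (inj₂ (inj₁ pb)) (inj₁ qa) =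
    crossing-neighbours-nonadjacent (Triangle-swap₁₂ abc) (Outside-swap₁₂ op) (Outside-swap₁₂ oq) pb qa
  triangle-neighbours-nonadjacent abc op oq (inj₂ (inj₁ pb)) (inj₂ (inj₁ qb)) =
    corner-neighbours-nonadjacent (Triangle-swap₁₂ abc) (Outside-swap₁₂ op) (Outside-swap₁₂ oq)
      (~-sym pb) (~-sym qb)
  triangle-neighbours-nonadjacent abc op oq (inj₂ (inj₁ pb)) (inj₂ (inj₂ qc)) =
    crossing-neighbours-nonadjacent (Triangle-rotate abc) (Outside-rotate op) (Outside-rotate oq) pb qc
  triangle-neighbours-nonadjacent abc op oq (inj₂ (inj₂ pc)) (inj₁ qa) =
    crossing-neighbours-nonadjacent (Triangle-rotate (Triangle-rotate abc))
      (Outside-rotate (Outside-rotate op)) (Outside-rotate (Outside-rotate oq)) pc qa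
  triangle-neighbours-nonadjacent abc op oq (inj₂ (inj₂ pc)) (inj₂ (inj₁ qb)) =
    crossing-neighbours-nonadjacent (Triangle-rotate (Triangle-swap₂₃ abc))
      (Outside-rotate (Outside-swap₂₃ op)) (Outside-rotate (Outside-swap₂₃ oq)) pc qb
  triangle-neighbours-nonadjacent abc op oq (inj₂ (inj₂ pc)) (inj₂ (inj₂ qc)) =
    corner-neighbours-nonadjacent (Triangle-rotate (Triangle-rotate abc))
      (Outside-rotate (Outside-rotate op)) (Outside-rotate (Outside-rotate oq)) (~-sym pc) (~-sym qc)

  locate : ∀ a b c x → x ≡ a ⊎ x ≡ b ⊎ x ≡ c ⊎ Outside a b c x
  locate a b c x with x ≟ a | x ≟ b | x ≟ c
  ... | yes x≡a | _       | _       = inj₁ x≡a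
  ... | no _    | yes x≡b | _       = inj₂ (inj₁ x≡b)
  ... | no _    | no _    | yes x≡c = inj₂ (inj₂ (inj₁ x≡c))
  ... | no x≢a  | no x≢b  | no x≢c  = inj₂ (inj₂ (inj₂ (x≢a , x≢b , x≢c)))

  no-triangle-through-corner : ∀ {a b c p r} → Triangle G a b c → Outside a b c p → p ~ a → a ~ r → ¬ p ~ r
  no-triangle-through-corner {a} {b} {c} {p} {r} abc op@(_ , p≢b , p≢c) pa ar pr with locate a b c r
  ... | inj₁ refl               = ~⇒≢ ar refl
  ... | inj₂ (inj₁ refl)        = p≢c (triangle-apex-unique abc pa pr)
  ... | inj₂ (inj₂ (inj₁ refl)) = p≢b (triangle-apex-unique (Triangle-swap₂₃ abc) pa pr)
  ... | inj₂ (inj₂ (inj₂ or))   = corner-neighbours-nonadjacent abc op or (~-sym pa) ar pr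

  triangles-disjoint : ∀ {a b c p q r} → Triangle G a b c → Triangle G p q r → Outside a b c p → Outside a b c q
  triangles-disjoint abc (triangle pq qr pr) op =
    (λ { refl → no-triangle-through-corner abc op pq qr pr }) ,
    (λ { refl → no-triangle-through-corner (Triangle-swap₁₂ abc) (Outside-swap₁₂ op) pq qr pr }) ,
    (λ { refl → no-triangle-through-corner (Triangle-rotate (Triangle-rotate abc))
                                          (Outside-rotate (Outside-rotate op)) pq qr pr })

  outer : Fin n → Fin n → Fin n → Fin n → Bool
  outer a b c x = adj G a x ∧ x ≠ᵛ b ∧ x ≠ᵛ c

  outer⁺ : ∀ {a b c x} → a ~ x → x ≢ b → x ≢ c → T (outer a b c x)
  outer⁺ ax x≢b x≢c = ax ∧ᵀ ≢⇒≠ᵛ x≢b ∧ᵀ ≢⇒≠ᵛ x≢c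

  outer⁻ : ∀ {a b c x} → T (outer a b c x) → a ~ x × x ≢ b × x ≢ c
  outer⁻ {a} {b} {c} {x} h =
    let (ax , h) = ∧ᵀ-split (adj G a x) h
        (x≢b , x≢c) = ∧ᵀ-split (x ≠ᵛ b) h
    in ax , toWitnessFalse x≢b , toWitnessFalse x≢c

  outer-swap : ∀ {a b c x} → T (outer a b c x) → T (outer a c b x)
  outer-swap h = let (ax , x≢b , x≢c) = outer⁻ h in outer⁺ ax x≢c x≢b

  outer⇒Outside : ∀ {a b c x} → T (outer a b c x) → Outside a b c x
  outer⇒Outside h = let (ax , x≢b , x≢c) = outer⁻ h in (~⇒≢ ax ∘ sym) , x≢b , x≢c

  outer-disjoint : ∀ {a b c x} → Triangle G a b c → T (outer a b c x) → T (outer b a c x) → ⊥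
  outer-disjoint abc x∈A x∈B =
    let (a~x , _ , x≢c) = outer⁻ x∈A
    in x≢c (triangle-apex-unique abc (~-sym a~x) (~-sym (proj₁ (outer⁻ x∈B))))

  far-vertex-meets-outer-neighbour : ∀ {a b c w} → w ≢ a → ¬ Near a b c w → ∃ λ m → T (outer a b c m) × m ~ w
  far-vertex-meets-outer-neighbour w≢a far with AddedEdge.common-neighbour-of-non-edge w≢a (far ∘ inj₁)
  ... | common-neighbour m m~w m~a _ =
    m , outer⁺ (~-sym m~a) (λ { refl → far (inj₂ (inj₁ (~-sym m~w))) }) (λ { refl → far (inj₂ (inj₂ (~-sym m~w))) })
      , m~w

  outer-neighbour : ∀ {a b c x y z} → Triangle G a b c → Triangle G x y z → Outside a b c x →
    ∃ λ v → T (outer a b c v)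
  outer-neighbour {a} {b} {c} abc xyz ox with any? (λ v → T? (outer a b c v))
  ... | yes found = found
  ... | no  none  = ⊥-elim (triangle-neighbours-nonadjacent abc ox oy (near ox) (near oy) (Triangle.a~b xyz))
    where
    oy = triangles-disjoint abc xyz ox
    near : ∀ {w} → Outside a b c w → Near a b c w
    near {w} ow = decidable-stable (w ~? a ⊎-dec w ~? b ⊎-dec w ~? c) λ far →
      let (m , m∈Na , _) = far-vertex-meets-outer-neighbour (proj₁ ow) far in none (m , m∈Na)

  OnTriangle : Fin n → Set
  OnTriangle x = ∃₂ λ y z → Triangle G x y z

  onTriangle? : ∀ x → Dec (OnTriangle x)
  onTriangle? x = any? λ y → any? λ z → triangle? y z
    where
    triangle? : ∀ y z → Dec (Triangle G x y z)
    triangle? y z = map′ (λ (xy , yz , xz) → triangle xy yz xz) (λ (triangle xy yz xz) → xy , yz , xz)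
                         (x ~? y ×-dec y ~? z ×-dec x ~? z)

  record CountedTriangleThrough (w : Fin n) : Set where
    field
      corners  : Fin n × Fin n × Fin n
      counted  : T (isTriangle (adj G) corners)
      contains : w ∈ triangleCorners corners
      adjacent : ∀ {v} → v ∈ triangleCorners corners → v ≡ w ⊎ w ~ v

  countedTriangleThrough : ∀ {w} → OnTriangle w → CountedTriangleThrough w
  countedTriangleThrough (_ , _ , wyz) =
    let (t , counted , t↭) = Triangle⇒isTriangle G wyz
    in record { corners  = t
              ; counted  = counted
              ; contains = ∈-resp-↭ (↭-sym t↭) (here refl)
              ; adjacent = Triangle-corner-adjacent wyz ∘ ∈-resp-↭ t↭
              }

  Satellite : Fin n → Fin n → Fin n → Fin n → Set
  Satellite a b c x = Outside a b c x × Near a b c x × OnTriangle x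

  three-satellites⇒4≤triangleCount : ∀ {a b c x y z} → Triangle G a b c →
    Satellite a b c x → Satellite a b c y → Satellite a b c z → x ≢ y → x ≢ z → y ≢ z →
    4 ≤ triangleCount (adj G)
  three-satellites⇒4≤triangleCount {a} {b} {c} abc sx sy sz x≢y x≢z y≢z =
    Unique⇒length≤triangleCount G
      ( (t₀≢ sx ∷ t₀≢ sy ∷ t₀≢ sz ∷ []) ∷ (apart sx sy x≢y ∷ apart sx sz x≢z ∷ []) ∷ (apart sy sz y≢z ∷ [])
      ∷ [] ∷ [])
      (t₀-counted ∷ counted sx ∷ counted sy ∷ counted sz ∷ [])
    where
    t₀ = proj₁ (Triangle⇒isTriangle G abc)
    t₀-counted = proj₁ (proj₂ (Triangle⇒isTriangle G abc))
    t₀↭ = proj₂ (proj₂ (Triangle⇒isTriangle G abc))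
    through : ∀ {w} → Satellite a b c w → CountedTriangleThrough w
    through (_ , _ , on) = countedTriangleThrough on
    counted : ∀ {w} (s : Satellite a b c w) →
      T (isTriangle (adj G) (CountedTriangleThrough.corners (through s)))
    counted s = CountedTriangleThrough.counted (through s)
    t₀≢ : ∀ {w} (s : Satellite a b c w) → t₀ ≢ CountedTriangleThrough.corners (through s)
    t₀≢ s@((w≢a , w≢b , w≢c) , _ , _) =
      corner-separates (CountedTriangleThrough.contains (through s))
        (All¬⇒¬Any (w≢a ∷ w≢b ∷ w≢c ∷ []) ∘ ∈-resp-↭ t₀↭)
    apart : ∀ {v w} (s : Satellite a b c v) (s′ : Satellite a b c w) → v ≢ w →
      CountedTriangleThrough.corners (through s) ≢ CountedTriangleThrough.corners (through s′)
    apart s@(ov , nv , _) s′@(ow , nw , _) v≢w =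
      corner-separates (CountedTriangleThrough.contains (through s′))
        ( [ v≢w ∘ sym , triangle-neighbours-nonadjacent abc ov ow nv nw ]′
        ∘ CountedTriangleThrough.adjacent (through s))

  count-onTriangle : (Fin n → Bool) → ℕ
  count-onTriangle P = count (λ x → P x ∧ ⌊ onTriangle? x ⌋)

  module NeighbourCounting {a b c u} (abc : Triangle G a b c) (u-outer : T (outer a b c u)) (u-off : ¬ OnTriangle u)
    where

    Na Nb Nu Na∖u : Fin n → Bool
    Na = outer a b c
    Nb = outer b a c
    Nu r = adj G u r ∧ r ≠ᵛ a
    Na∖u = Na ─ u

    private
      a~u = proj₁ (outer⁻ u-outer)
      u≢b = proj₁ (proj₂ (outer⁻ u-outer))
      u≢c = proj₂ (proj₂ (outer⁻ u-outer))
      u-out : Outside a b c u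
      u-out = outer⇒Outside u-outer
      u-near : Near a b c u
      u-near = inj₁ (~-sym a~u)

    module _ {r} (r∈Nu : T (Nu r)) where
      private
        u~r = proj₁ (∧ᵀ-split (adj G u r) r∈Nu)
        r≢a = toWitnessFalse (proj₂ (∧ᵀ-split (adj G u r) r∈Nu))
        r≢b : r ≢ b
        r≢b refl = u≢c (triangle-apex-unique abc (~-sym a~u) u~r)
        r≢c : r ≢ c
        r≢c refl = u≢b (triangle-apex-unique (Triangle-swap₂₃ abc) (~-sym a~u) u~r)
        r-out : Outside a b c r
        r-out = r≢a , r≢b , r≢c
        r≁b : ¬ r ~ b
        r≁b rb = triangle-neighbours-nonadjacent abc u-out r-out u-near (inj₂ (inj₁ rb)) u~r
        r≁c : ¬ r ~ c
        r≁c rc = triangle-neighbours-nonadjacent abc u-out r-out u-near (inj₂ (inj₂ rc)) u~r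
        r≁a : ¬ r ~ a
        r≁a ra = corner-neighbours-nonadjacent abc u-out r-out a~u (~-sym ra) u~r

      Nu-to-Nb : count (λ y → Nb y ∧ adj G r y) ≤ 2
      Nu-to-Nb = count≤2 (λ y → Nb y ∧ adj G r y) λ h₁ h₂ h₃ →
        no-three-common-neighbours r≢b r≁b
          (r-side h₁) (b-side h₁) (r-side h₂) (b-side h₂) (r-side h₃) (b-side h₃)
        where
        r-side : ∀ {y} → T (Nb y ∧ adj G r y) → y ~ r
        r-side {y} h = ~-sym (proj₂ (∧ᵀ-split (Nb y) h))
        b-side : ∀ {y} → T (Nb y ∧ adj G r y) → y ~ b
        b-side {y} h = ~-sym (proj₁ (outer⁻ (proj₁ (∧ᵀ-split (Nb y) h))))

      private
        in-Na∖u : ∀ {x} → x ~ r → x ~ a → x ≢ u → T (Na∖u x ∧ adj G r x)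
        in-Na∖u xr xa x≢u =
          (outer⁺ (~-sym xa) (λ { refl → r≁b (~-sym xr) }) (λ { refl → r≁c (~-sym xr) }) ∧ᵀ ≢⇒≠ᵛ x≢u)
          ∧ᵀ ~-sym xr

      Nu-to-Na∖u : 1 ≤ count (λ x → Na∖u x ∧ adj G r x)
      Nu-to-Na∖u with AddedEdge.common-neighbour-of-non-edge r≢a r≁a
      ... | common-neighbour w w~r w~a extra with w ≟ u
      ... | no w≢u = count≥1 (λ x → Na∖u x ∧ adj G r x) (in-Na∖u w~r w~a w≢u)
      ... | yes refl with extra
      ... | inj₁ (w′ , w′≢u , w′~r , w′~a) = count≥1 (λ x → Na∖u x ∧ adj G r x) (in-Na∖u w′~r w′~a w′≢u)
      ... | inj₂ (inj₁ (q , urq))          = ⊥-elim (u-off (_ , _ , urq))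
      ... | inj₂ (inj₂ (q , uaq))          = ⊥-elim (u-off (_ , _ , uaq))

    module _ {y} (y∈Nb : T (Nb y)) where
      private
        b~y = proj₁ (outer⁻ y∈Nb)
        y-out : Outside a b c y
        y-out = Outside-swap₁₂ (outer⇒Outside y∈Nb)
        y≢c = proj₂ (proj₂ y-out)
        u≢y : u ≢ y
        u≢y refl = u≢c (triangle-apex-unique abc (~-sym a~u) (~-sym b~y))
        u≁y : ¬ u ~ y
        u≁y = triangle-neighbours-nonadjacent abc u-out y-out u-near (inj₂ (inj₁ (~-sym b~y)))
        in-Nu : ∀ {w} → w ~ u → w ~ y → T (Nu w ∧ adj G w y)
        in-Nu wu wy =
          (~-sym wu ∧ᵀ ≢⇒≠ᵛ λ { refl → y≢c (triangle-apex-unique abc (~-sym wy) (~-sym b~y)) }) ∧ᵀ wy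

      Nb-to-Nu : 2 ≤ count (λ r → Nu r ∧ adj G r y) + (if ⌊ onTriangle? y ⌋ then 1 else 0)
      Nb-to-Nu with AddedEdge.common-neighbour-of-non-edge u≢y u≁y | onTriangle? y
      ... | common-neighbour w w~u w~y _ | yes _ =
        subst (2 ≤_) (+-comm 1 _) (s≤s (count≥1 (λ r → Nu r ∧ adj G r y) (in-Nu w~u w~y)))
      ... | common-neighbour w w~u w~y (inj₁ (w′ , w′≢w , w′~u , w′~y)) | no _ =
        subst (2 ≤_) (sym (+-identityʳ _))
          (count≥2 (λ r → Nu r ∧ adj G r y) (in-Nu w~u w~y) (in-Nu w′~u w′~y) (w′≢w ∘ sym))
      ... | common-neighbour _ _ _ (inj₂ (inj₁ (_ , wuq))) | no _     = ⊥-elim (u-off (_ , _ , Triangle-swap₁₂ wuq))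
      ... | common-neighbour _ _ _ (inj₂ (inj₂ (_ , wyq))) | no y-off = ⊥-elim (y-off (_ , _ , Triangle-swap₁₂ wyq))

    Na∖u-to-Nu : ∀ {x} → T (Na∖u x) → count (λ r → Nu r ∧ adj G r x) ≤ 1
    Na∖u-to-Nu {x} x∈Na∖u = count≤1 (λ r → Nu r ∧ adj G r x) λ {r₁} {r₂} h₁ h₂ → unique h₁ h₂ (r₁ ≟ r₂)
      where
      a~x = proj₁ (outer⁻ (proj₁ (∧ᵀ-split (Na x) x∈Na∖u)))
      x≢u = toWitnessFalse (proj₂ (∧ᵀ-split (Na x) x∈Na∖u))
      u≁x : ¬ u ~ x
      u≁x = corner-neighbours-nonadjacent abc u-out (outer⇒Outside (proj₁ (∧ᵀ-split (Na x) x∈Na∖u))) a~u a~x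
      unique : ∀ {r₁ r₂} → T (Nu r₁ ∧ adj G r₁ x) → T (Nu r₂ ∧ adj G r₂ x) → Dec (r₁ ≡ r₂) → r₁ ≡ r₂
      unique _  _  (yes r₁≡r₂) = r₁≡r₂
      unique {r₁} {r₂} h₁ h₂ (no r₁≢r₂) =
        let (N₁ , r₁~x) = ∧ᵀ-split (Nu r₁) h₁
            (N₂ , r₂~x) = ∧ᵀ-split (Nu r₂) h₂
            (u~r₁ , r₁≢a) = ∧ᵀ-split (adj G u r₁) N₁
            (u~r₂ , r₂≢a) = ∧ᵀ-split (adj G u r₂) N₂
        in ⊥-elim (no-three-common-neighbours (x≢u ∘ sym) u≁x a~u a~x (~-sym u~r₁) r₁~x (~-sym u~r₂) r₂~x
                     (toWitnessFalse r₁≢a ∘ sym) (toWitnessFalse r₂≢a ∘ sym) r₁≢r₂)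

    private
      Nu≤Na∖u : count Nu ≤ count Na∖u
      Nu≤Na∖u = double-counting Nu Na∖u (adj G) Nu-to-Na∖u Na∖u-to-Nu

      Nb≤Na∖u : count Nb + count Nb ≤ count Na∖u + count Na∖u + count-onTriangle Nb
      Nb≤Na∖u = begin
        count Nb + count Nb
          ≡⟨ ∑⟨⟩-distrib-+ Nb (λ _ → 1) (λ _ → 1) ⟨
        ∑⟨ Nb ⟩ (λ _ → 2)
          ≤⟨ ∑⟨⟩-mono-≤ Nb Nb-to-Nu ⟩
        ∑⟨ Nb ⟩ (λ y → degree y + on y)
          ≡⟨ ∑⟨⟩-distrib-+ Nb degree on ⟩
        ∑⟨ Nb ⟩ degree + ∑⟨ Nb ⟩ on
          ≡⟨ cong (∑⟨ Nb ⟩ degree +_) (∑⟨⟩-indicator Nb (λ y → ⌊ onTriangle? y ⌋)) ⟩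
        ∑⟨ Nb ⟩ degree + count-onTriangle Nb
          ≤⟨ +-monoˡ-≤ (count-onTriangle Nb)
                       (double-counting Nb Nu (λ y r → adj G r y) (λ _ → ≤-refl) Nu-to-Nb) ⟩
        ∑⟨ Nu ⟩ (λ _ → 2) + count-onTriangle Nb
          ≡⟨ cong (_+ count-onTriangle Nb) (∑⟨⟩-distrib-+ Nu (λ _ → 1) (λ _ → 1)) ⟩
        count Nu + count Nu + count-onTriangle Nb
          ≤⟨ +-monoˡ-≤ (count-onTriangle Nb) (+-mono-≤ Nu≤Na∖u Nu≤Na∖u) ⟩
        count Na∖u + count Na∖u + count-onTriangle Nb ∎
        where
        open ≤-Reasoning
        degree on : Fin n → ℕ
        degree y = count (λ r → Nu r ∧ adj G r y)
        on y = if ⌊ onTriangle? y ⌋ then 1 else 0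

    neighbour-count-bound : count Nb + count Nb + 2 ≤ count Na + count Na + count-onTriangle Nb
    neighbour-count-bound rewrite count-remove Na u-outer =
      subst (count Nb + count Nb + 2 ≤_) (shift (count Na∖u) (count-onTriangle Nb)) (+-monoˡ-≤ 2 Nb≤Na∖u)
      where
      shift : ∀ m k → m + m + k + 2 ≡ suc m + suc m + k
      shift m k = trans (+-comm (m + m + k) 2) (cong (λ j → suc j + k) (sym (+-suc m m)))

  module _ (few : triangleCount (adj G) ≤ 3) where

    four-triangles-impossible : ¬ 4 ≤ triangleCount (adj G)
    four-triangles-impossible four = contradiction (≤-trans four few) λ { (s≤s (s≤s (s≤s ()))) }

    off-triangle-neighbours-at-two-corners⇒⊥ : ∀ {a b c u y} → Triangle G a b c →
      T (outer a b c u) → ¬ OnTriangle u → T (outer b a c y) → ¬ OnTriangle y → ⊥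
    off-triangle-neighbours-at-two-corners⇒⊥ {a} {b} {c} abc u∈Na u-off y∈Nb y-off =
      contradiction (≤-trans four at-most-two) λ { (s≤s (s≤s ())) }
      where
      Na Nb : Fin n → Bool
      Na = outer a b c
      Nb = outer b a c
      four : 4 ≤ count-onTriangle Na + count-onTriangle Nb
      four = cross-bounds _ _ _ _ (NeighbourCounting.neighbour-count-bound (Triangle-swap₁₂ abc) y∈Nb y-off)
                                 (NeighbourCounting.neighbour-count-bound abc u∈Na u-off)
      satellite : ∀ {x} → T ((Na x ∧ ⌊ onTriangle? x ⌋) ∨ (Nb x ∧ ⌊ onTriangle? x ⌋)) → Satellite a b c x
      satellite {x} h with ∨ᵀ-cases (Na x ∧ ⌊ onTriangle? x ⌋) h
      ... | inj₁ h = let (x∈Na , on) = ∧ᵀ-split (Na x) h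
                     in outer⇒Outside x∈Na , inj₁ (~-sym (proj₁ (outer⁻ x∈Na))) , toWitness on
      ... | inj₂ h = let (x∈Nb , on) = ∧ᵀ-split (Nb x) h
                     in Outside-swap₁₂ (outer⇒Outside x∈Nb) , inj₂ (inj₁ (~-sym (proj₁ (outer⁻ x∈Nb))))
                        , toWitness on
      disjoint : ∀ x → T (Na x ∧ ⌊ onTriangle? x ⌋) → T (Nb x ∧ ⌊ onTriangle? x ⌋) → ⊥
      disjoint x hNa hNb = outer-disjoint abc (proj₁ (∧ᵀ-split (Na x) hNa)) (proj₁ (∧ᵀ-split (Nb x) hNb))
      at-most-two : count-onTriangle Na + count-onTriangle Nb ≤ 2
      at-most-two = subst (_≤ 2) (count-∨ _ _ disjoint) (count≤2 _ λ hx hy hz x≢y x≢z y≢z →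
        four-triangles-impossible
          (three-satellites⇒4≤triangleCount abc (satellite hx) (satellite hy) (satellite hz) x≢y x≢z y≢z))

    AllOuterOnTriangles : Fin n → Fin n → Fin n → Set
    AllOuterOnTriangles a b c = ∀ {v} → T (outer a b c v) → OnTriangle v

    sole-outer-neighbour : ∀ {a b c x x′ v} → Triangle G a b c → AllOuterOnTriangles a b c →
      T (outer a b c x) → T (outer b a c x′) → OnTriangle x′ → T (outer a b c v) → v ≡ x
    sole-outer-neighbour {a} {b} {c} {x} {v = v} abc all-a x∈Na x′∈Nb x′-on v∈Na with v ≟ x
    ... | yes v≡x = v≡x
    ... | no  v≢x = ⊥-elim (four-triangles-impossible
      (three-satellites⇒4≤triangleCount abc (satellite-a x∈Na) x′-sat (satellite-a v∈Na)
        (λ { refl → outer-disjoint abc x∈Na x′∈Nb }) (v≢x ∘ sym) λ { refl → outer-disjoint abc v∈Na x′∈Nb }))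
      where
      satellite-a : ∀ {w} → T (outer a b c w) → Satellite a b c w
      satellite-a w∈Na = outer⇒Outside w∈Na , inj₁ (~-sym (proj₁ (outer⁻ w∈Na))) , all-a w∈Na
      x′-sat = Outside-swap₁₂ (outer⇒Outside x′∈Nb) , inj₂ (inj₁ (~-sym (proj₁ (outer⁻ x′∈Nb)))) , x′-on

    all-outer-on-triangles-at-two-corners⇒⊥ : ∀ {a b c p q r} → Triangle G a b c → Triangle G p q r →
      Outside a b c p → AllOuterOnTriangles a b c → AllOuterOnTriangles b a c → ⊥
    all-outer-on-triangles-at-two-corners⇒⊥ {a} {b} {c} abc pqr op all-a all-b =
      let (x , x∈Na) = outer-neighbour abc pqr op
          (x′ , x′∈Nb) = outer-neighbour (Triangle-swap₁₂ abc) pqr (Outside-swap₁₂ op)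
      in around x∈Na x′∈Nb (all-a x∈Na) (all-b x′∈Nb)
      where
      around : ∀ {x x′} → T (outer a b c x) → T (outer b a c x′) → OnTriangle x → OnTriangle x′ → ⊥
      around {x} {x′} x∈Na x′∈Nb (y , z , xyz) (_ , _ , x′st) =
        corner-neighbours-nonadjacent xyz (beyond-x x′st) (beyond-x (Triangle-swap₂₃ x′st))
          (sees x′st) (sees (Triangle-swap₂₃ x′st)) (Triangle.b~c x′st)
        where
        x-out = outer⇒Outside x∈Na
        x-near = inj₁ (~-sym (proj₁ (outer⁻ x∈Na)))
        x′-out = Outside-swap₁₂ (outer⇒Outside x′∈Nb)
        x′-near = inj₂ (inj₁ (~-sym (proj₁ (outer⁻ x′∈Nb))))
        x≁x′ = triangle-neighbours-nonadjacent abc x-out x′-out x-near x′-near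
        sees : ∀ {s t} → Triangle G x′ s t → x ~ s
        sees x′st =
          let s-out = triangles-disjoint abc x′st x′-out
              far = λ s-near →
                triangle-neighbours-nonadjacent abc x′-out s-out x′-near s-near (Triangle.a~b x′st)
              (m , m∈Na , m~s) = far-vertex-meets-outer-neighbour (proj₁ s-out) far
          in subst (_~ _) (sole-outer-neighbour abc all-a x∈Na x′∈Nb (_ , _ , x′st) m∈Na) m~s
        beyond-x : ∀ {s t} → Triangle G x′ s t → Outside x y z s
        beyond-x x′st = triangles-disjoint xyz x′st
          ( (λ { refl → outer-disjoint abc x∈Na x′∈Nb })
          , (λ { refl → x≁x′ (Triangle.a~b xyz) })
          , (λ { refl → x≁x′ (Triangle.a~c xyz) }))

    HasOffTriangleNeighbour : Fin n → Fin n → Fin n → Set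
    HasOffTriangleNeighbour a b c = ∃ λ u → T (outer a b c u) × ¬ OnTriangle u

    off-or-all-on-triangles : ∀ a b c → HasOffTriangleNeighbour a b c ⊎ AllOuterOnTriangles a b c
    off-or-all-on-triangles a b c with any? (λ u → T? (outer a b c u) ×-dec ¬? (onTriangle? u))
    ... | yes found = inj₁ found
    ... | no  none  = inj₂ λ {v} v∈A → decidable-stable (onTriangle? v) (λ v-off → none (v , v∈A , v-off))

    no-second-triangle : ∀ {a b c p q r} → Triangle G a b c → Triangle G p q r → Outside a b c p → ⊥
    no-second-triangle {a} {b} {c} abc pqr op
      with off-or-all-on-triangles a b c | off-or-all-on-triangles b a c | off-or-all-on-triangles c a b
    ... | inj₁ (u , u∈ , u-off) | inj₁ (y , y∈ , y-off) | _ =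
      off-triangle-neighbours-at-two-corners⇒⊥ abc u∈ u-off y∈ y-off
    ... | inj₁ (u , u∈ , u-off) | inj₂ _ | inj₁ (z , z∈ , z-off) =
      off-triangle-neighbours-at-two-corners⇒⊥ (Triangle-swap₂₃ abc) (outer-swap u∈) u-off z∈ z-off
    ... | inj₁ _ | inj₂ all-b | inj₂ all-c =
      all-outer-on-triangles-at-two-corners⇒⊥ (Triangle-rotate abc) pqr (Outside-rotate op)
        (all-b ∘ outer-swap) (all-c ∘ outer-swap)
    ... | inj₂ _ | inj₁ (y , y∈ , y-off) | inj₁ (z , z∈ , z-off) =
      off-triangle-neighbours-at-two-corners⇒⊥ (Triangle-rotate abc) (outer-swap y∈) y-off (outer-swap z∈) z-off
    ... | inj₂ all-a | inj₁ _ | inj₂ all-c =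
      all-outer-on-triangles-at-two-corners⇒⊥ (Triangle-swap₂₃ abc) pqr (Outside-swap₂₃ op)
        (all-a ∘ outer-swap) all-c
    ... | inj₂ all-a | inj₂ all-b | _ =
      all-outer-on-triangles-at-two-corners⇒⊥ abc pqr op all-a all-b

    fewer-than-two-triangles : ¬ 2 ≤ triangleCount (adj G)
    fewer-than-two-triangles two =
      let (t , t′ , t≢t′ , t-counted , t′-counted) = triangleCount≥2⇒distinct G two
          (x , x∈t′ , x∉t) = distinct-triangles⇒outside-corner G t-counted t′-counted t≢t′
          (_ , _ , xyz) = Triangle-through-corner (isTriangle⇒Triangle G t′-counted) x∈t′
      in no-second-triangle (isTriangle⇒Triangle G t-counted) xyz
           ((x∉t ∘ here) , (x∉t ∘ there ∘ here) , (x∉t ∘ there ∘ there ∘ here))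

theorem3p7 : (n : ℕ) (G : Graph n) → UniquelyDiamondSaturated G →
    (triangleCount (adj G) ≢ 2) × (triangleCount (adj G) ≢ 3)
theorem3p7 n G uds =
    (λ two   → fewer-than-two-triangles (≤-trans (≤-reflexive two) (n≤1+n 2)) (≤-reflexive (sym two)))
  , (λ three → fewer-than-two-triangles (≤-reflexive three) (≤-trans (n≤1+n 2) (≤-reflexive (sym three))))
  where open UniquelySaturated G uds using (fewer-than-two-triangles)
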